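{- For every natural number $n\geq 2$, \[ \varphi^3(n)+\psi^3(n)+\sigma^3(n)\geq 3n^3+3n^2+9n+1. \]
   Context: For a natural number $n$, $\varphi(n)$ is Euler's totient function (the number of positive integers not exceeding $n$ that are coprime to $n$). For $n=p_1^{a_1}\cdots p_k^{a_k}$ (distinct primes $p_i$, $a_i\geq1$), the Dedekind function is $\psi(n)=\prod_{i=1}^k p_i^{a_i-1}(p_i+1)$, with $\psi(1)=1$. $\sigma(n)$ denotes the sum of the positive divisors of $n$. -}

module Defs where

open import Data.Nat using (ℕ; zero; suc; _+_; _*_; _∸_; _^_)
open import Data.Nat.Divisibility using (_∣?_)
open import Data.Nat.Coprimality using (coprime?)
open import Data.Nat.Primality using (prime?)
open import Data.List using (List; filter; length; map)
open import Data.Nat.ListAction using (sum; product)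
open import Data.List.Base using (upTo)

range1 : ℕ → List ℕ
range1 n = map suc (upTo n)

φ : ℕ → ℕ
φ n = length (filter (λ k → coprime? k n) (range1 n))

σ : ℕ → ℕ
σ n = sum (filter (λ d → d ∣? n) (range1 n))

-- p-adic valuation for prime p and n ≥ 1: #{ 1 ≤ k ≤ n : p^k ∣ n }
-- (since p ≥ 2, p^k ∣ n with n ≥ 1 forces k ≤ n, so this counts exactly
--  the k with 1 ≤ k ≤ v_p(n))
val : ℕ → ℕ → ℕ
val p n = length (filter (λ k → (p ^ k) ∣? n) (range1 n))

primeDivisors : ℕ → List ℕ
primeDivisors n = filter (λ p → p ∣? n) (filter prime? (range1 n))

ψ : ℕ → ℕ
ψ n = product (map (λ p → p ^ (val p n ∸ 1) * (p + 1)) (primeDivisors n))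

-- Write n = φ(n) + t with t ≥ 1. Every k ≤ n not coprime to n satisfies n ∣ k d for the proper
-- divisor d = n / gcd(k, n), and exactly d such k exist; hence t ≤ σ(n) - n, i.e. σ(n) ≥ n + t.
-- Comparing ∏ p^(v_p(n)), a multiple of n, factorwise with ψ(n) = ∏ p^(v_p(n)-1)(p+1) gives
-- ψ(n) ≥ n + 1. Finally (n - t)³ + (n + t)³ = 2n³ + 6nt² ≥ 2n³ + 6n, and adding (n + 1)³ gives
-- the bound.
module Submission where

open import Defs

open import Data.Bool.Base using (true; false; if_then_else_)
open import Data.List.Base using (List; []; _∷_; _++_; [_]; filter; length; map; upTo)
open import Data.List.Properties using (filter-++; filter-accept; filter-reject; map-++; upTo-∷ʳ; map-id)
open import Data.List.Relation.Unary.All using (_∷_)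
open import Data.Nat.Base
open import Data.Nat.Coprimality using (Coprime; coprime?; coprime-divisor; gcd≡1⇒coprime)
open import Data.Nat.Divisibility
open import Data.Nat.GCD using (gcd; gcd[m,n]∣m; gcd[m,n]∣n; gcd[m,n]≢0)
open import Data.Nat.Induction using (<-rec)
open import Data.Nat.ListAction using (sum; product)
open import Data.Nat.ListAction.Properties using (sum-++; product-++)
open import Data.Nat.Primality
  using (Prime; prime?; prime⇒nonTrivial; prime⇒nonZero; prime⇒irreducible; ¬prime[1]; euclidsLemma)
open import Data.Nat.Primality.Factorisation using (factorise)
open import Data.Nat.Properties
open import Algebra.Properties.CommutativeSemigroup +-commutativeSemigroup
  using (x∙yz≈y∙xz) renaming (interchange to +-interchange)
open import Data.Nat.Solver using (module +-*-Solver)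
open import Data.Product.Base using (_×_; _,_; ∃-syntax)
open import Data.Sum.Base using (inj₁; inj₂)
open import Function.Base using (id; const; _∘_)
open import Level using (Level)
open import Relation.Binary.PropositionalEquality
  using (_≡_; _≢_; refl; sym; trans; cong; cong₂; subst; subst₂; module ≡-Reasoning)
open import Relation.Nullary.Decidable using (yes; no; does; _×-dec_; ¬?; dec-true; dec-false)
open import Relation.Nullary.Negation using (¬_; contradiction)
open import Relation.Unary using (Pred; Decidable; _≐_)

private variable
  ℓ₁ ℓ₂ ℓ₃ : Level
  A : Pred ℕ ℓ₁
  P : Pred ℕ ℓ₂
  Q : Pred ℕ ℓ₃

sumWhere : Decidable P → (ℕ → ℕ) → ℕ → ℕ
sumWhere P? f zero    = 0
sumWhere P? f (suc n) = (if does (P? (suc n)) then f (suc n) else 0) + sumWhere P? f n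

countWhere : Decidable P → ℕ → ℕ
countWhere P? = sumWhere P? (const 1)

productWhere : Decidable P → (ℕ → ℕ) → ℕ → ℕ
productWhere P? f zero    = 1
productWhere P? f (suc n) = (if does (P? (suc n)) then f (suc n) else 1) * productWhere P? f n

range1-suc : ∀ n → range1 (suc n) ≡ range1 n ++ [ suc n ]
range1-suc n = trans (cong (map suc) (sym (upTo-∷ʳ n))) (map-++ suc (upTo n) [ n ])

module _ (P? : Decidable P) (f : ℕ → ℕ) where

  sum-map-filter-[_] : ∀ x → sum (map f (filter P? [ x ])) ≡ (if does (P? x) then f x else 0)
  sum-map-filter-[ x ] with does (P? x)
  ... | true  = +-identityʳ (f x)
  ... | false = refl

  product-map-filter-[_] : ∀ x → product (map f (filter P? [ x ])) ≡ (if does (P? x) then f x else 1)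
  product-map-filter-[ x ] with does (P? x)
  ... | true  = *-identityʳ (f x)
  ... | false = refl

  sum-map-filter-range1 : ∀ n → sum (map f (filter P? (range1 n))) ≡ sumWhere P? f n
  sum-map-filter-range1 zero    = refl
  sum-map-filter-range1 (suc n) = begin
    sum (map f (filter P? (range1 (suc n))))
      ≡⟨ cong (sum ∘ map f ∘ filter P?) (range1-suc n) ⟩
    sum (map f (filter P? (range1 n ++ [ suc n ])))
      ≡⟨ cong (sum ∘ map f) (filter-++ P? (range1 n) [ suc n ]) ⟩
    sum (map f (filter P? (range1 n) ++ filter P? [ suc n ]))
      ≡⟨ cong sum (map-++ f (filter P? (range1 n)) (filter P? [ suc n ])) ⟩
    sum (map f (filter P? (range1 n)) ++ map f (filter P? [ suc n ]))
      ≡⟨ sum-++ (map f (filter P? (range1 n))) (map f (filter P? [ suc n ])) ⟩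
    sum (map f (filter P? (range1 n))) + sum (map f (filter P? [ suc n ]))
      ≡⟨ cong₂ _+_ (sum-map-filter-range1 n) sum-map-filter-[ suc n ] ⟩
    sumWhere P? f n + (if does (P? (suc n)) then f (suc n) else 0)
      ≡⟨ +-comm (sumWhere P? f n) _ ⟩
    sumWhere P? f (suc n) ∎
    where open ≡-Reasoning

  product-map-filter-range1 : ∀ n → product (map f (filter P? (range1 n))) ≡ productWhere P? f n
  product-map-filter-range1 zero    = refl
  product-map-filter-range1 (suc n) = begin
    product (map f (filter P? (range1 (suc n))))
      ≡⟨ cong (product ∘ map f ∘ filter P?) (range1-suc n) ⟩
    product (map f (filter P? (range1 n ++ [ suc n ])))
      ≡⟨ cong (product ∘ map f) (filter-++ P? (range1 n) [ suc n ]) ⟩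
    product (map f (filter P? (range1 n) ++ filter P? [ suc n ]))
      ≡⟨ cong product (map-++ f (filter P? (range1 n)) (filter P? [ suc n ])) ⟩
    product (map f (filter P? (range1 n)) ++ map f (filter P? [ suc n ]))
      ≡⟨ product-++ (map f (filter P? (range1 n))) (map f (filter P? [ suc n ])) ⟩
    product (map f (filter P? (range1 n))) * product (map f (filter P? [ suc n ]))
      ≡⟨ cong₂ _*_ (product-map-filter-range1 n) product-map-filter-[ suc n ] ⟩
    productWhere P? f n * (if does (P? (suc n)) then f (suc n) else 1)
      ≡⟨ *-comm (productWhere P? f n) _ ⟩
    productWhere P? f (suc n) ∎
    where open ≡-Reasoning

length≡sum-map-const-1 : ∀ (xs : List ℕ) → length xs ≡ sum (map (const 1) xs)
length≡sum-map-const-1 []       = refl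
length≡sum-map-const-1 (x ∷ xs) = cong suc (length≡sum-map-const-1 xs)

length-filter-range1 : ∀ (P? : Decidable P) n → length (filter P? (range1 n)) ≡ countWhere P? n
length-filter-range1 P? n =
  trans (length≡sum-map-const-1 (filter P? (range1 n))) (sum-map-filter-range1 P? (const 1) n)

sum-filter-range1 : ∀ (P? : Decidable P) n → sum (filter P? (range1 n)) ≡ sumWhere P? id n
sum-filter-range1 P? n =
  trans (cong sum (sym (map-id (filter P? (range1 n))))) (sum-map-filter-range1 P? id n)

filter-filter : ∀ (P? : Decidable P) (Q? : Decidable Q) xs →
                filter Q? (filter P? xs) ≡ filter (λ x → P? x ×-dec Q? x) xs
filter-filter P? Q? []       = refl
filter-filter P? Q? (x ∷ xs) with P? x | Q? x
... | yes _ | yes q = trans (filter-accept Q? q) (cong (x ∷_) (filter-filter P? Q? xs))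
... | yes _ | no ¬q = trans (filter-reject Q? ¬q) (filter-filter P? Q? xs)
... | no  _ | _     = filter-filter P? Q? xs

module _ (P? : Decidable P) {n : ℕ} where

  countWhere-accept : P (suc n) → countWhere P? (suc n) ≡ suc (countWhere P? n)
  countWhere-accept p = cong (λ b → (if b then 1 else 0) + countWhere P? n) (dec-true (P? (suc n)) p)

  countWhere-reject : ¬ P (suc n) → countWhere P? (suc n) ≡ countWhere P? n
  countWhere-reject ¬p = cong (λ b → (if b then 1 else 0) + countWhere P? n) (dec-false (P? (suc n)) ¬p)

countWhere-complement : ∀ (P? : Decidable P) n → countWhere P? n + countWhere (¬? ∘ P?) n ≡ n
countWhere-complement P? zero = refl
countWhere-complement P? (suc n) with P? (suc n)
... | yes _ = cong suc (countWhere-complement P? n)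
... | no  _ = trans (+-suc (countWhere P? n) _) (cong suc (countWhere-complement P? n))

countWhere-≤ : ∀ (P? : Decidable P) n → countWhere P? n ≤ n
countWhere-≤ P? zero = z≤n
countWhere-≤ P? (suc n) with P? (suc n)
... | yes _ = s≤s (countWhere-≤ P? n)
... | no  _ = m≤n⇒m≤1+n (countWhere-≤ P? n)

≤-countWhere : ∀ (P? : Decidable P) {k n} → (∀ {j} → j ≤ k → P j) → k ≤ n → k ≤ countWhere P? n
≤-countWhere P? {n = zero}  _   z≤n   = z≤n
≤-countWhere P? {k} {suc n} Pk≤ k≤1+n with m≤n⇒m<n∨m≡n k≤1+n | P? (suc n)
... | inj₁ (s≤s k≤n) | _     = ≤-trans (≤-countWhere P? Pk≤ k≤n) (m≤n+m _ _)
... | inj₂ refl      | yes _ = s≤s (≤-countWhere P? (Pk≤ ∘ m≤n⇒m≤1+n) ≤-refl)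
... | inj₂ refl      | no ¬P = contradiction (Pk≤ ≤-refl) ¬P

countWhere-≐ : ∀ (P? : Decidable P) (Q? : Decidable Q) → P ≐ Q → ∀ n → countWhere P? n ≡ countWhere Q? n
countWhere-≐ P? Q? P≐Q zero = refl
countWhere-≐ P? Q? (P⊆Q , Q⊆P) (suc n) with P? (suc n) | Q? (suc n)
... | yes _ | yes _ = cong suc (countWhere-≐ P? Q? (P⊆Q , Q⊆P) n)
... | no  _ | no  _ = countWhere-≐ P? Q? (P⊆Q , Q⊆P) n
... | yes p | no ¬q = contradiction (P⊆Q p) ¬q
... | no ¬p | yes q = contradiction (Q⊆P q) ¬p

module _ (P? : Decidable P) where

  sumWhere-cong : ∀ {f g} → (∀ {i} → P i → f i ≡ g i) → ∀ n → sumWhere P? f n ≡ sumWhere P? g n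
  sumWhere-cong f≗g zero = refl
  sumWhere-cong f≗g (suc n) with P? (suc n)
  ... | yes p = cong₂ _+_ (f≗g p) (sumWhere-cong f≗g n)
  ... | no  _ = sumWhere-cong f≗g n

  sumWhere-mono-≤ : ∀ {f g} → (∀ i → f i ≤ g i) → ∀ n → sumWhere P? f n ≤ sumWhere P? g n
  sumWhere-mono-≤ f≤g zero = z≤n
  sumWhere-mono-≤ f≤g (suc n) with P? (suc n)
  ... | yes _ = +-mono-≤ (f≤g (suc n)) (sumWhere-mono-≤ f≤g n)
  ... | no  _ = sumWhere-mono-≤ f≤g n

  sumWhere-distrib-+ : ∀ f g n → sumWhere P? (λ i → f i + g i) n ≡ sumWhere P? f n + sumWhere P? g n
  sumWhere-distrib-+ f g zero = refl
  sumWhere-distrib-+ f g (suc n) with P? (suc n)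
  ... | yes _ = trans (cong (f (suc n) + g (suc n) +_) (sumWhere-distrib-+ f g n))
                      (+-interchange (f (suc n)) (g (suc n)) (sumWhere P? f n) (sumWhere P? g n))
  ... | no  _ = sumWhere-distrib-+ f g n

  sumWhere-member : ∀ f {i n} → P i → 1 ≤ i → i ≤ n → f i ≤ sumWhere P? f n
  sumWhere-member f {n = zero} _ (s≤s _) ()
  sumWhere-member f {i} {suc n} Pi 1≤i i≤1+n with m≤n⇒m<n∨m≡n i≤1+n | P? (suc n)
  ... | inj₁ (s≤s i≤n) | _     = ≤-trans (sumWhere-member f Pi 1≤i i≤n) (m≤n+m _ _)
  ... | inj₂ refl      | yes _ = m≤m+n (f i) _
  ... | inj₂ refl      | no ¬P = contradiction Pi ¬P

union-bound : ∀ {r q} {R : Pred ℕ r} {Q : ℕ → ℕ → Set q}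
              (A? : Decidable A) (R? : Decidable R) (Q? : ∀ d → Decidable (Q d)) {M} →
              (∀ {k} → A k → ∃[ d ] 1 ≤ d × d ≤ M × R d × Q d k) →
              ∀ N → countWhere A? N ≤ sumWhere R? (λ d → countWhere (Q? d) N) M
union-bound A? R? Q? cover zero = z≤n
union-bound A? R? Q? {M} cover (suc N) with A? (suc N)
... | no _ = begin
  countWhere A? N                                   ≤⟨ union-bound A? R? Q? cover N ⟩
  sumWhere R? (λ d → countWhere (Q? d) N) M         ≤⟨ sumWhere-mono-≤ R? (λ d → m≤n+m _ _) M ⟩
  sumWhere R? (λ d → countWhere (Q? d) (suc N)) M   ∎
  where open ≤-Reasoning
... | yes Ak with cover Ak
...   | d , 1≤d , d≤M , Rd , Qdk = begin
  1 + countWhere A? N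
    ≤⟨ +-mono-≤ (≤-trans (≤-reflexive (sym hit)) (sumWhere-member R? hits Rd 1≤d d≤M))
                (union-bound A? R? Q? cover N) ⟩
  sumWhere R? hits M + sumWhere R? (λ d → countWhere (Q? d) N) M
    ≡⟨ sumWhere-distrib-+ R? hits (λ d → countWhere (Q? d) N) M ⟨
  sumWhere R? (λ d → countWhere (Q? d) (suc N)) M   ∎
  where
  open ≤-Reasoning
  hits : ℕ → ℕ
  hits d = if does (Q? d (suc N)) then 1 else 0
  hit : hits d ≡ 1
  hit = cong (λ b → if b then 1 else 0) (dec-true (Q? d (suc N)) Qdk)

module _ (P? : Decidable P) where

  productWhere-∣-suc : ∀ f n → productWhere P? f n ∣ productWhere P? f (suc n)
  productWhere-∣-suc f n = n∣m*n (if does (P? (suc n)) then f (suc n) else 1)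

  productWhere-member-∣ : ∀ f {i n} → P i → 1 ≤ i → i ≤ n → f i ∣ productWhere P? f n
  productWhere-member-∣ f {n = zero} _ (s≤s _) ()
  productWhere-member-∣ f {i} {suc n} Pi 1≤i i≤1+n with m≤n⇒m<n∨m≡n i≤1+n
  ... | inj₁ (s≤s i≤n) = ∣-trans (productWhere-member-∣ f Pi 1≤i i≤n) (productWhere-∣-suc f n)
  ... | inj₂ refl with P? i
  ...   | yes _ = m∣m*n _
  ...   | no ¬P = contradiction Pi ¬P

  productWhere-pos : ∀ {f} → (∀ {i} → P i → 0 < f i) → ∀ n → 0 < productWhere P? f n
  productWhere-pos f>0 zero = z<s
  productWhere-pos f>0 (suc n) with P? (suc n)
  ... | yes p = *-mono-≤ (f>0 p) (productWhere-pos f>0 n)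
  ... | no  _ = ≤-trans (productWhere-pos f>0 n) (m≤m+n _ 0)

  productWhere-mono-≤ : ∀ {f g} → (∀ {i} → P i → f i ≤ g i) → ∀ n → productWhere P? f n ≤ productWhere P? g n
  productWhere-mono-≤ f≤g zero = ≤-refl
  productWhere-mono-≤ f≤g (suc n) with P? (suc n)
  ... | yes p = *-mono-≤ (f≤g p) (productWhere-mono-≤ f≤g n)
  ... | no  _ = *-monoʳ-≤ 1 (productWhere-mono-≤ f≤g n)

  productWhere-mono-< : ∀ {f g} → (∀ {i} → P i → f i < g i) →
                        ∀ {i n} → P i → 1 ≤ i → i ≤ n → productWhere P? f n < productWhere P? g n
  productWhere-mono-< f<g {n = zero} _ (s≤s _) ()
  productWhere-mono-< {f} {g} f<g {i} {suc n} Pi 1≤i i≤1+n with P? (suc n)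
  ... | yes p = ≤-<-trans (*-monoʳ-≤ (f (suc n)) (productWhere-mono-≤ (<⇒≤ ∘ f<g) n))
                          (*-monoˡ-< _ {{>-nonZero (productWhere-pos (λ q → ≤-<-trans z≤n (f<g q)) n)}} (f<g p))
  ... | no ¬p = *-monoʳ-< 1 (productWhere-mono-< f<g Pi 1≤i (s≤s⁻¹ (≤∧≢⇒< i≤1+n λ { refl → ¬p Pi })))

prime-divisor : ∀ {m} → 2 ≤ m → ∃[ p ] Prime p × p ∣ m
prime-divisor {m} (s≤s (s≤s _)) with factorise m
... | record { factors = [] ; isFactorisation = () }
... | record { factors = p ∷ ps ; isFactorisation = m≡p*Πps ; factorsPrime = prime[p] ∷ _ } =
  p , prime[p] , divides (product ps) (trans m≡p*Πps (*-comm p (product ps)))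

n<m^n : ∀ {m} → 1 < m → ∀ n → n < m ^ n
n<m^n 1<m zero    = z<s
n<m^n {m} 1<m (suc n) = ≤-<-trans (n<m^n 1<m n) (^-monoʳ-< m 1<m (n<1+n n))

^-monoʳ-∣ : ∀ m {j k} → j ≤ k → m ^ j ∣ m ^ k
^-monoʳ-∣ m {j} {k} j≤k = divides (m ^ (k ∸ j)) (begin
  m ^ k               ≡⟨ cong (m ^_) (m+[n∸m]≡n j≤k) ⟨
  m ^ (j + (k ∸ j))   ≡⟨ ^-distribˡ-+-* m j (k ∸ j) ⟩
  m ^ j * m ^ (k ∸ j) ≡⟨ *-comm (m ^ j) _ ⟩
  m ^ (k ∸ j) * m ^ j ∎)
  where open ≡-Reasoning

prime∣^⇒∣ : ∀ {p m} k → Prime p → p ∣ m ^ k → p ∣ m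
prime∣^⇒∣ zero    pp p∣1 = contradiction (subst Prime (∣1⇒≡1 p∣1) pp) ¬prime[1]
prime∣^⇒∣ {m = m} (suc k) pp p∣m^[1+k] with euclidsLemma m (m ^ k) pp p∣m^[1+k]
... | inj₁ p∣m   = p∣m
... | inj₂ p∣m^k = prime∣^⇒∣ k pp p∣m^k

coprime-^-prime : ∀ {r p} k → Prime r → Prime p → r ≢ p → Coprime (r ^ k) p
coprime-^-prime k pr pp r≢p (d∣r^k , d∣p) with prime⇒irreducible pp d∣p
... | inj₁ d≡1 = d≡1
... | inj₂ refl with prime⇒irreducible pr (prime∣^⇒∣ k pp d∣r^k)
...   | inj₁ p≡1 = contradiction (subst Prime p≡1 pp) ¬prime[1]
...   | inj₂ p≡r = contradiction (sym p≡r) r≢p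

-- Peel off one prime p ∣ m: m = q p and g = h p, and the prime powers dividing q still divide h.
prime-powers-∣⇒∣ : ∀ m .{{_ : NonZero m}} {g} → (∀ {p} k → Prime p → p ^ k ∣ m → p ^ k ∣ g) → m ∣ g
prime-powers-∣⇒∣ = <-rec Goal step
  where
  Goal : ℕ → Set
  Goal m = .{{NonZero m}} → ∀ {g} → (∀ {p} k → Prime p → p ^ k ∣ m → p ^ k ∣ g) → m ∣ g

  step : ∀ m → (∀ {q} → q < m → Goal q) → Goal m
  step 1 _ _ = 1∣ _
  step m@(suc (suc _)) rec {g} powers∣g with prime-divisor {m} (s≤s (s≤s z≤n))
  ... | p , pp , p∣m = subst₂ _∣_ (sym m≡q*p) (sym g≡h*p) (*-monoˡ-∣ p q∣h)
    where
    instance _ = prime⇒nonTrivial pp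
    instance _ = prime⇒nonZero pp
    p^1≡p : p ^ 1 ≡ p
    p^1≡p = *-identityʳ p
    p∣g : p ∣ g
    p∣g = subst (_∣ g) p^1≡p (powers∣g 1 pp (subst (_∣ m) (sym p^1≡p) p∣m))
    q = quotient p∣m
    h = quotient p∣g
    instance _ = quotient≢0 p∣m
    m≡q*p : m ≡ q * p
    m≡q*p = m∣n⇒n≡quotient*m p∣m
    g≡h*p : g ≡ h * p
    g≡h*p = m∣n⇒n≡quotient*m p∣g
    g≡p*h : g ≡ p * h
    g≡p*h = trans g≡h*p (*-comm h p)
    powers∣h : ∀ {r} k → Prime r → r ^ k ∣ q → r ^ k ∣ h
    powers∣h {r} k pr r^k∣q with r ≟ p
    ... | yes refl = *-cancelˡ-∣ p (subst (p ^ suc k ∣_) g≡p*h (powers∣g (suc k) pp p^[1+k]∣m))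
      where
      p^[1+k]∣m : p ^ suc k ∣ m
      p^[1+k]∣m = subst₂ _∣_ (*-comm (p ^ k) p) (sym m≡q*p) (*-monoˡ-∣ p r^k∣q)
    ... | no r≢p = coprime-divisor (coprime-^-prime k pr pp r≢p)
                     (subst (r ^ k ∣_) g≡p*h (powers∣g k pr (∣-trans r^k∣q (quotient-∣ p∣m))))
    q∣h : q ∣ h
    q∣h = rec (quotient-< p∣m) powers∣h

φ≡countWhere : ∀ n → φ n ≡ countWhere (λ k → coprime? k n) n
φ≡countWhere n = length-filter-range1 (λ k → coprime? k n) n

σ≡sumWhere : ∀ n → σ n ≡ sumWhere (_∣? n) id n
σ≡sumWhere n = sum-filter-range1 (_∣? n) n

φ<n : ∀ {n} → 2 ≤ n → φ n < n
φ<n {n@(suc m)} (s≤s 1≤m) = begin-strict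
  φ n                ≡⟨ φ≡countWhere n ⟩
  countWhere Cop? n  ≡⟨ countWhere-reject Cop? ¬n⊥n ⟩
  countWhere Cop? m  ≤⟨ countWhere-≤ Cop? m ⟩
  m                  <⟨ n<1+n m ⟩
  n                  ∎
  where
  open ≤-Reasoning
  Cop? = λ k → coprime? k n
  ¬n⊥n : ¬ Coprime n n
  ¬n⊥n n⊥n = >⇒≢ 1≤m (suc-injective (n⊥n (∣-refl , ∣-refl)))

countWhere-∣ : ∀ {c} .{{_ : NonZero c}} d {j} → j < c → countWhere (c ∣?_) (j + d * c) ≡ d
countWhere-∣ zero    {zero} _ = refl
countWhere-∣ {suc c} (suc d) {zero} _ =
  trans (countWhere-accept (suc c ∣?_) (n∣m*n (suc d))) (cong suc (countWhere-∣ d ≤-refl))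
countWhere-∣ {c} d {suc j} j<c =
  trans (countWhere-reject (c ∣?_) c∤j+dc) (countWhere-∣ d (<-trans (n<1+n j) j<c))
  where
  c∤j+dc : ¬ c ∣ suc j + d * c
  c∤j+dc c∣j+dc = >⇒∤ j<c (∣m+n∣m⇒∣n (subst (c ∣_) (+-comm (suc j) (d * c)) c∣j+dc) (n∣m*n d))

∣⇒nonZero : ∀ {d n} .{{_ : NonZero n}} → d ∣ n → NonZero d
∣⇒nonZero {zero} {n} 0∣n = contradiction (0∣⇒≡0 0∣n) (≢-nonZero⁻¹ n)
∣⇒nonZero {suc _} _ = _

-- With n = c d, the k ≤ n for which n ∣ k d are the multiples of c.
countWhere-∣-* : ∀ {n d} .{{_ : NonZero n}} → d ∣ n → countWhere (λ k → n ∣? k * d) n ≡ d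
countWhere-∣-* {n} {d} d∣n = begin
  countWhere (λ k → n ∣? k * d) n ≡⟨ countWhere-≐ (λ k → n ∣? k * d) (c ∣?_) (n∣kd⇒c∣k , c∣k⇒n∣kd) n ⟩
  countWhere (c ∣?_) n            ≡⟨ cong (countWhere (c ∣?_)) (trans n≡c*d (*-comm c d)) ⟩
  countWhere (c ∣?_) (d * c)      ≡⟨ countWhere-∣ d (>-nonZero⁻¹ c) ⟩
  d                               ∎
  where
  open ≡-Reasoning
  c = quotient d∣n
  instance _ = quotient≢0 d∣n
  instance _ = ∣⇒nonZero d∣n
  n≡c*d : n ≡ c * d
  n≡c*d = m∣n⇒n≡quotient*m d∣n
  n∣kd⇒c∣k : ∀ {k} → n ∣ k * d → c ∣ k
  n∣kd⇒c∣k n∣kd = *-cancelʳ-∣ d (subst (_∣ _) n≡c*d n∣kd)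
  c∣k⇒n∣kd : ∀ {k} → c ∣ k → n ∣ k * d
  c∣k⇒n∣kd c∣k = subst (_∣ _) (sym n≡c*d) (*-monoˡ-∣ d c∣k)

¬coprime⇒proper-divisor : ∀ {k n} .{{_ : NonZero n}} → ¬ Coprime k n →
                          ∃[ d ] 0 < d × d < n × d ∣ n × n ∣ k * d
¬coprime⇒proper-divisor {k} {n} ¬k⊥n =
  d , >-nonZero⁻¹ d {{quotient≢0 g∣n}} , quotient-< g∣n {{g>1}} , quotient-∣ g∣n , divides k′ kd≡k′n
  where
  g = gcd k n
  g∣n = gcd[m,n]∣n k n
  d = quotient g∣n
  k′ = quotient (gcd[m,n]∣m k n)
  g>1 : NonTrivial g
  g>1 = n>1⇒nonTrivial (≤∧≢⇒< (n≢0⇒n>0 (gcd[m,n]≢0 k n (inj₂ (≢-nonZero⁻¹ n))))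
                               λ 1≡g → ¬k⊥n (gcd≡1⇒coprime (sym 1≡g)))
  kd≡k′n : k * d ≡ k′ * n
  kd≡k′n = begin
    k * d         ≡⟨ cong (_* d) (m∣n⇒n≡quotient*m (gcd[m,n]∣m k n)) ⟩
    k′ * g * d    ≡⟨ *-assoc k′ g d ⟩
    k′ * (g * d)  ≡⟨ cong (k′ *_) (trans (*-comm g d) (sym (m∣n⇒n≡quotient*m g∣n))) ⟩
    k′ * n        ∎
    where open ≡-Reasoning

σ≡n+sumWhere : ∀ m → σ (suc m) ≡ suc m + sumWhere (_∣? suc m) id m
σ≡n+sumWhere m = trans (σ≡sumWhere (suc m))
  (cong (λ b → (if b then suc m else 0) + sumWhere (_∣? suc m) id m) (dec-true (suc m ∣? suc m) ∣-refl))

n≤φ+sumWhere : ∀ m → suc m ≤ φ (suc m) + sumWhere (_∣? suc m) id m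
n≤φ+sumWhere m = begin
  n
    ≡⟨ countWhere-complement Cop? n ⟨
  countWhere Cop? n + countWhere (¬? ∘ Cop?) n
    ≤⟨ +-monoʳ-≤ _ (union-bound (¬? ∘ Cop?) (_∣? n) (λ d k → n ∣? k * d) cover n) ⟩
  countWhere Cop? n + sumWhere (_∣? n) (λ d → countWhere (λ k → n ∣? k * d) n) m
    ≡⟨ cong₂ _+_ (sym (φ≡countWhere n)) (sumWhere-cong (_∣? n) countWhere-∣-* m) ⟩
  φ n + sumWhere (_∣? n) id m
    ∎
  where
  open ≤-Reasoning
  n = suc m
  Cop? = λ k → coprime? k n
  cover : ∀ {k} → ¬ Coprime k n → ∃[ d ] 1 ≤ d × d ≤ m × d ∣ n × n ∣ k * d
  cover ¬k⊥n with ¬coprime⇒proper-divisor ¬k⊥n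
  ... | d , d>0 , d<n , d∣n , n∣kd = d , d>0 , s≤s⁻¹ d<n , d∣n , n∣kd

n+n≤φ+σ : ∀ n .{{_ : NonZero n}} → n + n ≤ φ n + σ n
n+n≤φ+σ n@(suc m) = begin
  n + n                                  ≤⟨ +-monoʳ-≤ n (n≤φ+sumWhere m) ⟩
  n + (φ n + sumWhere (_∣? n) id m)      ≡⟨ x∙yz≈y∙xz n (φ n) _ ⟩
  φ n + (n + sumWhere (_∣? n) id m)      ≡⟨ cong (φ n +_) (σ≡n+sumWhere m) ⟨
  φ n + σ n                              ∎
  where open ≤-Reasoning

PrimeDivisorOf : ℕ → ℕ → Set
PrimeDivisorOf n p = Prime p × p ∣ n

primeDivisorOf? : ∀ n → Decidable (PrimeDivisorOf n)
primeDivisorOf? n p = prime? p ×-dec p ∣? n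

ψ≡productWhere : ∀ n → ψ n ≡ productWhere (primeDivisorOf? n) (λ p → p ^ (val p n ∸ 1) * (p + 1)) n
ψ≡productWhere n = trans
  (cong (product ∘ map (λ p → p ^ (val p n ∸ 1) * (p + 1))) (filter-filter prime? (_∣? n) (range1 n)))
  (product-map-filter-range1 (primeDivisorOf? n) _ n)

prime>1 : ∀ {p} → Prime p → 1 < p
prime>1 {p} pp = nonTrivial⇒n>1 p {{prime⇒nonTrivial pp}}

^∣⇒≤val : ∀ {p n} k .{{_ : NonZero n}} → 1 < p → p ^ k ∣ n → k ≤ val p n
^∣⇒≤val {p} {n} k 1<p p^k∣n = subst (k ≤_) (sym (length-filter-range1 (λ j → p ^ j ∣? n) n))
  (≤-countWhere (λ j → p ^ j ∣? n) (λ j≤k → ∣-trans (^-monoʳ-∣ p j≤k) p^k∣n)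
    (<⇒≤ (<-≤-trans (n<m^n 1<p k) (∣⇒≤ p^k∣n))))

n∣productWhere-^val : ∀ n .{{_ : NonZero n}} → n ∣ productWhere (primeDivisorOf? n) (λ p → p ^ val p n) n
n∣productWhere-^val n = prime-powers-∣⇒∣ n p^k∣F
  where
  p^k∣F : ∀ {p} k → Prime p → p ^ k ∣ n → p ^ k ∣ productWhere (primeDivisorOf? n) (λ p → p ^ val p n) n
  p^k∣F zero          _  _      = 1∣ _
  p^k∣F {p} (suc k) pp p^k∣n = ∣-trans (^-monoʳ-∣ p (^∣⇒≤val (suc k) (prime>1 pp) p^k∣n))
    (productWhere-member-∣ (primeDivisorOf? n) _ (pp , p∣n) (<⇒≤ (prime>1 pp)) (∣⇒≤ p∣n))
    where
    p∣n : p ∣ n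
    p∣n = ∣-trans (m∣m*n (p ^ k)) p^k∣n

m^n<m^[n∸1]*[m+1] : ∀ {p v} .{{_ : NonZero p}} → 0 < v → p ^ v < p ^ (v ∸ 1) * (p + 1)
m^n<m^[n∸1]*[m+1] {p} {suc t} _ = begin-strict
  p * p ^ t            <⟨ m<m+n (p * p ^ t) (m^n>0 p t) ⟩
  p * p ^ t + p ^ t    ≡⟨ cong (_+ p ^ t) (*-comm p (p ^ t)) ⟩
  p ^ t * p + p ^ t     ≡⟨ cong (p ^ t * p +_) (*-identityʳ (p ^ t)) ⟨
  p ^ t * p + p ^ t * 1 ≡⟨ *-distribˡ-+ (p ^ t) p 1 ⟨
  p ^ t * (p + 1)      ∎
  where open ≤-Reasoning

n<ψ : ∀ {n} → 2 ≤ n → n < ψ n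
n<ψ {n} 2≤n@(s≤s (s≤s _)) with prime-divisor 2≤n
... | p , pp , p∣n = begin-strict
  n
    ≤⟨ ∣⇒≤ {{>-nonZero (productWhere-pos (primeDivisorOf? n) pow>0 n)}} (n∣productWhere-^val n) ⟩
  productWhere (primeDivisorOf? n) (λ q → q ^ val q n) n
    <⟨ productWhere-mono-< (primeDivisorOf? n) pow<ψ-factor (pp , p∣n) (<⇒≤ (prime>1 pp)) (∣⇒≤ p∣n) ⟩
  productWhere (primeDivisorOf? n) (λ q → q ^ (val q n ∸ 1) * (q + 1)) n
    ≡⟨ ψ≡productWhere n ⟨
  ψ n
    ∎
  where
  open ≤-Reasoning
  pow>0 : ∀ {q} → PrimeDivisorOf n q → 0 < q ^ val q n
  pow>0 {q} (pq , _) = m^n>0 q {{prime⇒nonZero pq}} (val q n)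
  pow<ψ-factor : ∀ {q} → PrimeDivisorOf n q → q ^ val q n < q ^ (val q n ∸ 1) * (q + 1)
  pow<ψ-factor {q} (pq , q∣n) = m^n<m^[n∸1]*[m+1] {{prime⇒nonZero pq}}
    (^∣⇒≤val 1 (prime>1 pq) (subst (_∣ n) (sym (*-identityʳ q)) q∣n))

-- (n - t)³ + (n + t)³ = 2n³ + 6nt², here with n = 1 + x + u and t = 1 + u.
cube-sum-identity : ∀ x u → let n = 1 + x + u in
  x ^ 3 + (1 + n) ^ 3 + (n + (1 + u)) ^ 3 ≡
  3 * n ^ 3 + 3 * n ^ 2 + 9 * n + 1 + 6 * n * (u * (u + 2))
cube-sum-identity = solve 2 (λ x u →
  x :^ 3 :+ (con 1 :+ (con 1 :+ x :+ u)) :^ 3 :+ ((con 1 :+ x :+ u) :+ (con 1 :+ u)) :^ 3 :=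
  con 3 :* (con 1 :+ x :+ u) :^ 3 :+ con 3 :* (con 1 :+ x :+ u) :^ 2 :+ con 9 :* (con 1 :+ x :+ u) :+ con 1
    :+ con 6 :* (con 1 :+ x :+ u) :* (u :* (u :+ con 2))) refl
  where open +-*-Solver

cube-sum-bound : ∀ {n x s p} → x < n → n + n ≤ x + s → n < p →
  3 * n ^ 3 + 3 * n ^ 2 + 9 * n + 1 ≤ x ^ 3 + p ^ 3 + s ^ 3
cube-sum-bound {x = x} {s} {p} x<n 2n≤x+s n<p with m≤n⇒∃[o]m+o≡n x<n
... | u , refl = begin
  3 * n ^ 3 + 3 * n ^ 2 + 9 * n + 1
    ≤⟨ m≤m+n _ _ ⟩
  3 * n ^ 3 + 3 * n ^ 2 + 9 * n + 1 + 6 * n * (u * (u + 2))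
    ≡⟨ cube-sum-identity x u ⟨
  x ^ 3 + (1 + n) ^ 3 + (n + t) ^ 3
    ≤⟨ +-mono-≤ (+-monoʳ-≤ (x ^ 3) (^-monoˡ-≤ 3 n<p)) (^-monoˡ-≤ 3 n+t≤s) ⟩
  x ^ 3 + p ^ 3 + s ^ 3
    ∎
  where
  open ≤-Reasoning
  n = suc x + u
  t = suc u
  n+t≤s : n + t ≤ s
  n+t≤s = +-cancelˡ-≤ x (n + t) s (subst (_≤ x + s) n+n≡x+[n+t] 2n≤x+s)
    where
    n+n≡x+[n+t] : n + n ≡ x + (n + t)
    n+n≡x+[n+t] = solve 2 (λ x u → (con 1 :+ x :+ u) :+ (con 1 :+ x :+ u) :=
                                   x :+ ((con 1 :+ x :+ u) :+ (con 1 :+ u))) refl x u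
      where open +-*-Solver

theorem1 : (n : ℕ) → 2 ≤ n →
    3 * n ^ 3 + 3 * n ^ 2 + 9 * n + 1 ≤ φ n ^ 3 + ψ n ^ 3 + σ n ^ 3
theorem1 n 2≤n@(s≤s (s≤s _)) = cube-sum-bound (φ<n 2≤n) (n+n≤φ+σ n) (n<ψ 2≤n)
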